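{- Let $P_n=v_1v_2\cdots v_n$ be a path with a distribution of pebbles, $p(v_i)$ pebbles on $v_i$. For $1\le k\le n$ define $$\omega_{P_n}(v_k)=\sum_{i=1}^{k-1}2^{i-1}p(v_i)+\sum_{j=k+1}^{n}2^{n-j}p(v_j).$$ Let $t$ be a positive integer. If either $\frac{n+1}{2}\le k\le n$ and $\omega_{P_n}(v_k)\ge t2^{k-1}+2^{n-k}-1$, or $1\le k<\frac{n+1}{2}$ and $\omega_{P_n}(v_k)\ge 2^{k-1}+t2^{n-k}-1$, then at least $t$ pebbles can be moved from $P_n\setminus v_k$ to $v_k$ by a sequence of pebbling moves.
   Context: A pebbling move removes two pebbles from a vertex and places one pebble on an adjacent vertex. Empty sums are $0$. -}

module Defs where

open import Data.Nat using (ℕ; zero; suc; _+_; _*_; _∸_; _^_; _≤_; _<_)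
open import Data.Fin using (Fin; toℕ)
open import Data.Vec using (Vec; lookup; tabulate; _[_]%=_)
open import Data.Vec using () renaming (sum to vsum)
open import Relation.Nullary using (does)
open import Data.Nat using (_<?_)
open import Data.Bool using (if_then_else_)
open import Relation.Binary.PropositionalEquality using (_≡_)
open import Data.Sum using (_⊎_)
open import Relation.Binary.Construct.Closure.ReflexiveTransitive using (Star)

-- Path P_n = v_1 ... v_n; vertex v_{i+1} is represented by (i : Fin n).
-- A distribution is a vector of pebble counts.
Distribution : ℕ → Set
Distribution n = Vec ℕ n

Adjacent : {n : ℕ} → Fin n → Fin n → Set
Adjacent i j = (suc (toℕ i) ≡ toℕ j) ⊎ (suc (toℕ j) ≡ toℕ i)

data Move {n : ℕ} (p : Distribution n) : Distribution n → Set where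
  move : (i j : Fin n) → Adjacent i j → 2 ≤ lookup p i →
         Move p ((p [ i ]%= (λ x → x ∸ 2)) [ j ]%= suc)

Reachable : {n : ℕ} → Distribution n → Distribution n → Set
Reachable = Star Move

-- ω_{P_n}(v_{k+1}) for k : Fin n (0-indexed):
--   sum_{i<k} 2^i p_i + sum_{j>k} 2^(n-1-j) p_j   (0-indexed)
ω : {n : ℕ} → Distribution n → Fin n → ℕ
ω {n} p k = vsum (tabulate term)
  where
  term : Fin n → ℕ
  term i = if does (toℕ i <? toℕ k) then 2 ^ toℕ i * lookup p i
           else (if does (toℕ k <? toℕ i) then 2 ^ (n ∸ suc (toℕ i)) * lookup p i else 0)

-- Write L = Σ_{i<k} 2^{i-1} p(v_i) and R = Σ_{j>k} 2^{n-j} p(v_j), so that ω(v_k) = L + R.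
-- Sweeping pebbles greedily along v_1 → v_k, every move halving them, brings ⌊L / 2^{k-1}⌋
-- pebbles to v_k without touching v_{k+1}, …, v_n; sweeping along v_n → v_k then brings
-- ⌊R / 2^{n-k}⌋ more. Whichever of 2^{k-1}, 2^{n-k} is the larger, the bound on ω makes the
-- two floors add up to at least t.
module Submission where

open import Defs
open import Data.Nat
  using (ℕ; zero; suc; _+_; _*_; _∸_; _^_; _≤_; _<_; s≤s; s≤s⁻¹; s<s⁻¹; _<?_; NonZero)
open import Data.Nat.Properties
open import Data.Nat.DivMod using (_/_; _%_; m%n<n; m≡m%n+[m/n]*n; m/n*n≤m)
open import Data.Fin using (Fin; toℕ; fromℕ<) renaming (zero to fzero; suc to fsuc)
open import Data.Fin.Properties using (toℕ<n; toℕ-fromℕ<)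
open import Data.Vec using ([]; _∷_; lookup; tabulate; _[_]%=_) renaming (sum to vsum)
open import Data.Product using (Σ; _×_; _,_)
open import Data.Sum using (_⊎_; inj₁; inj₂; [_,_]′)
open import Function using (_∘_; id)
open import Relation.Nullary using (contradiction; does)
open import Relation.Nullary.Decidable using (dec-true; dec-false)
open import Data.Bool using (if_then_else_)
open import Relation.Binary.PropositionalEquality
open import Relation.Binary.Construct.Closure.ReflexiveTransitive using (ε; _◅_; _◅◅_)

-- Vertex v_{x+1} of the path is the natural number x; `at` reads 0 off the path.
at : ∀ {n} → Distribution n → ℕ → ℕ
at []       _       = 0
at (a ∷ p)  zero    = a
at (a ∷ p)  (suc x) = at p x

at-toℕ : ∀ {n} (p : Distribution n) (i : Fin n) → at p (toℕ i) ≡ lookup p i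
at-toℕ (a ∷ p) fzero    = refl
at-toℕ (a ∷ p) (fsuc i) = at-toℕ p i

at-updated : ∀ {n} (p : Distribution n) (i : Fin n) (f : ℕ → ℕ) →
             at (p [ i ]%= f) (toℕ i) ≡ f (at p (toℕ i))
at-updated (a ∷ p) fzero    f = refl
at-updated (a ∷ p) (fsuc i) f = at-updated p i f

at-not-updated : ∀ {n} (p : Distribution n) (i : Fin n) (f : ℕ → ℕ) {x} →
                 x ≢ toℕ i → at (p [ i ]%= f) x ≡ at p x
at-not-updated (a ∷ p) fzero    f {zero}  x≢i = contradiction refl x≢i
at-not-updated (a ∷ p) fzero    f {suc x} x≢i = refl
at-not-updated (a ∷ p) (fsuc i) f {zero}  x≢i = refl
at-not-updated (a ∷ p) (fsuc i) f {suc x} x≢i = at-not-updated p i f (x≢i ∘ cong suc)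

AdjacentAt : ℕ → ℕ → Set
AdjacentAt x y = (suc x ≡ y) ⊎ (suc y ≡ x)

AdjacentAt⇒≢ : ∀ {x y} → AdjacentAt x y → x ≢ y
AdjacentAt⇒≢ (inj₁ 1+x≡y) refl = 1+n≢n 1+x≡y
AdjacentAt⇒≢ (inj₂ 1+y≡x) refl = 1+n≢n 1+y≡x

pebblingMove : ∀ {n} (p : Distribution n) {x y} → x < n → y < n → AdjacentAt x y → 2 ≤ at p x →
  Σ (Distribution n) λ q → Move p q × at q x ≡ at p x ∸ 2 × at q y ≡ suc (at p y)
                            × (∀ z → z ≢ x → z ≢ y → at q z ≡ at p z)
pebblingMove p x<n y<n adj 2≤px
  with fromℕ< x<n | toℕ-fromℕ< x<n | fromℕ< y<n | toℕ-fromℕ< y<n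
... | i | refl | j | refl =
  q , move i j adj (subst (2 ≤_) (at-toℕ p i) 2≤px) , from , to , elsewhere
  where
  p′ = p [ i ]%= (_∸ 2)
  q  = p′ [ j ]%= suc
  i≢j = AdjacentAt⇒≢ adj
  from : at q (toℕ i) ≡ at p (toℕ i) ∸ 2
  from = trans (at-not-updated p′ j suc i≢j) (at-updated p i (_∸ 2))
  to : at q (toℕ j) ≡ suc (at p (toℕ j))
  to = trans (at-updated p′ j suc) (cong suc (at-not-updated p i (_∸ 2) (i≢j ∘ sym)))
  elsewhere : ∀ z → z ≢ toℕ i → z ≢ toℕ j → at q z ≡ at p z
  elsewhere z z≢i z≢j = trans (at-not-updated p′ j suc z≢j) (at-not-updated p i (_∸ 2) z≢i)

pebblingMoves : ∀ {n} m (p : Distribution n) {x y} → x < n → y < n → AdjacentAt x y →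
  2 * m ≤ at p x →
  Σ (Distribution n) λ q → Reachable p q × at q y ≡ at p y + m
                            × (∀ z → z ≢ x → z ≢ y → at q z ≡ at p z)
pebblingMoves zero p x<n y<n adj _ = p , ε , sym (+-identityʳ _) , λ _ _ _ → refl
pebblingMoves (suc m) p x<n y<n adj 2+2m≤px rewrite *-suc 2 m
  with pebblingMove p x<n y<n adj (≤-trans (m≤m+n 2 (2 * m)) 2+2m≤px)
... | p₁ , p↝p₁ , from₁ , to₁ , elsewhere₁
  with pebblingMoves m p₁ x<n y<n adj (subst (2 * m ≤_) (sym from₁) (∸-monoˡ-≤ 2 2+2m≤px))
... | q , p₁↠q , to , elsewhere =
  q , p↝p₁ ◅ p₁↠q ,
  trans to (trans (cong (_+ m) to₁) (sym (+-suc _ m))) ,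
  λ z z≢x z≢y → trans (elsewhere z z≢x z≢y) (elsewhere₁ z z≢x z≢y)

sumBelow : ℕ → (ℕ → ℕ) → ℕ
sumBelow zero    f = 0
sumBelow (suc e) f = sumBelow e f + f e

sumBelow-cong : ∀ e {f g : ℕ → ℕ} → (∀ {c} → c < e → f c ≡ g c) → sumBelow e f ≡ sumBelow e g
sumBelow-cong zero    f≗g = refl
sumBelow-cong (suc e) f≗g = cong₂ _+_ (sumBelow-cong e (f≗g ∘ m≤n⇒m≤1+n)) (f≗g ≤-refl)

sumBelow-+ : ∀ a b f → sumBelow (a + b) f ≡ sumBelow a f + sumBelow b (λ c → f (a + c))
sumBelow-+ a zero    f = trans (cong (λ e → sumBelow e f) (+-identityʳ a)) (sym (+-identityʳ _))
sumBelow-+ a (suc b) f rewrite +-suc a b =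
  trans (cong (_+ f (a + b)) (sumBelow-+ a b f)) (+-assoc (sumBelow a f) _ _)

sumBelow-reverse : ∀ e f → sumBelow e f ≡ sumBelow e (λ c → f (e ∸ suc c))
sumBelow-reverse zero    f = refl
sumBelow-reverse (suc e) f =
  trans (cong (_+ f e) (sumBelow-reverse e f))
        (trans (+-comm _ (f e)) (sym (sumBelow-+ 1 e (λ c → f (suc e ∸ suc c)))))

sum-tabulate : ∀ {n} (f : Fin n → ℕ) (g : ℕ → ℕ) → (∀ i → f i ≡ g (toℕ i)) →
               vsum (tabulate f) ≡ sumBelow n g
sum-tabulate {zero}  f g f≗g = refl
sum-tabulate {suc n} f g f≗g =
  trans (cong₂ _+_ (f≗g fzero) (sum-tabulate (f ∘ fsuc) (g ∘ suc) (f≗g ∘ fsuc)))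
        (sym (sumBelow-+ 1 n g))

weight : (ℕ → ℕ) → (ℕ → ℕ) → ℕ → ℕ
weight pos A e = sumBelow e (λ d → 2 ^ d * A (pos d))

weight-cong : ∀ pos A B e → (∀ {d} → d < e → A (pos d) ≡ B (pos d)) →
              weight pos A e ≡ weight pos B e
weight-cong pos A B e A≗B = sumBelow-cong e λ {d} d<e → cong (2 ^ d *_) (A≗B d<e)

record IsPath (n : ℕ) (pos : ℕ → ℕ) (e : ℕ) : Set where
  field
    adjacent : ∀ {c} → c < e → AdjacentAt (pos c) (pos (suc c))
    onPath   : ∀ {c} → c ≤ e → pos c < n
    distinct : ∀ {c d} → c < d → d ≤ e → pos c ≢ pos d
open IsPath

IsPath-init : ∀ {n pos e} → IsPath n pos (suc e) → IsPath n pos e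
IsPath-init path = record
  { adjacent = λ c<e → adjacent path (m≤n⇒m≤1+n c<e)
  ; onPath   = λ c≤e → onPath path (m≤n⇒m≤1+n c≤e)
  ; distinct = λ c<d d≤e → distinct path c<d (m≤n⇒m≤1+n d≤e)
  }

halve-demand : ∀ m u a w → m * (2 * u) ≤ w + u * a → (2 * m ∸ a) * u ≤ w
halve-demand m u a w m2u≤w+ua = begin
  (2 * m ∸ a) * u     ≡⟨ *-distribʳ-∸ u (2 * m) a ⟩
  2 * m * u ∸ a * u   ≤⟨ m≤n+o⇒m∸n≤o (2 * m * u) (a * u) (subst₂ _≤_ 2mu≡ ua+w≡ m2u≤w+ua) ⟩
  w                   ∎
  where
  open ≤-Reasoning
  2mu≡ : m * (2 * u) ≡ 2 * m * u
  2mu≡ = trans (sym (*-assoc m 2 u)) (cong (_* u) (*-comm m 2))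
  ua+w≡ : w + u * a ≡ a * u + w
  ua+w≡ = trans (+-comm w (u * a)) (cong (_+ w) (*-comm u a))

-- To deliver m pebbles to pos (e+1), gather 2m pebbles on pos e first: of these, all but the
-- at p (pos e) already there are requested recursively from the shorter path.
sweep : ∀ {n pos e} → IsPath n pos e → (p : Distribution n) (m : ℕ) →
  m * 2 ^ e ≤ weight pos (at p) e →
  Σ (Distribution n) λ q → Reachable p q × at p (pos e) + m ≤ at q (pos e)
                            × (∀ z → (∀ d → d ≤ e → z ≢ pos d) → at q z ≡ at p z)
sweep {e = zero}  path p zero    _  = p , ε , ≤-reflexive (+-identityʳ _) , λ _ _ → refl
sweep {e = zero}  path p (suc m) ()
sweep {pos = pos} {e = suc e} path p m m2^[1+e]≤w
  with sweep (IsPath-init path) p (2 * m ∸ at p (pos e))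
             (halve-demand m (2 ^ e) (at p (pos e)) _ m2^[1+e]≤w)
... | q₁ , p↠q₁ , gain₁ , elsewhere₁
  with pebblingMoves m q₁ (onPath path (n≤1+n e)) (onPath path ≤-refl) (adjacent path ≤-refl)
                     (≤-trans (m≤n+m∸n (2 * m) (at p (pos e))) gain₁)
... | q , q₁↠q , to , elsewhere = q , p↠q₁ ◅◅ q₁↠q , gain , elsewhere′
  where
  new : at q₁ (pos (suc e)) ≡ at p (pos (suc e))
  new = elsewhere₁ (pos (suc e)) λ d d≤e → distinct path (s≤s d≤e) ≤-refl ∘ sym
  gain : at p (pos (suc e)) + m ≤ at q (pos (suc e))
  gain = ≤-reflexive (sym (trans to (cong (_+ m) new)))
  elsewhere′ : ∀ z → (∀ d → d ≤ suc e → z ≢ pos d) → at q z ≡ at p z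
  elsewhere′ z off = trans (elsewhere z (off e (n≤1+n e)) (off (suc e) ≤-refl))
                           (elsewhere₁ z λ d d≤e → off d (m≤n⇒m≤1+n d≤e))

-- Sweeping the first path leaves the pebbles of the second, hence its weight, unchanged.
sweep-both : ∀ {n pos₁ pos₂ e₁ e₂} → IsPath n pos₁ e₁ → IsPath n pos₂ e₂ → pos₂ e₂ ≡ pos₁ e₁ →
  (∀ {c} → c < e₂ → ∀ d → d ≤ e₁ → pos₂ c ≢ pos₁ d) →
  (p : Distribution n) (m₁ m₂ : ℕ) →
  m₁ * 2 ^ e₁ ≤ weight pos₁ (at p) e₁ → m₂ * 2 ^ e₂ ≤ weight pos₂ (at p) e₂ →
  Σ (Distribution n) λ q → Reachable p q × at p (pos₁ e₁) + (m₁ + m₂) ≤ at q (pos₁ e₁)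
sweep-both {pos₁ = pos₁} {pos₂} {e₁} {e₂} path₁ path₂ meet disjoint p m₁ m₂ enough₁ enough₂
  with sweep path₁ p m₁ enough₁
... | q₁ , p↠q₁ , gain₁ , outside₁
  with sweep path₂ q₁ m₂ (subst (m₂ * 2 ^ e₂ ≤_)
         (weight-cong pos₂ (at p) (at q₁) e₂ λ c<e₂ → sym (outside₁ _ (disjoint c<e₂))) enough₂)
... | q , q₁↠q , gain₂ , _ = q , p↠q₁ ◅◅ q₁↠q , (begin
  at p v + (m₁ + m₂)  ≡⟨ +-assoc (at p v) m₁ m₂ ⟨
  at p v + m₁ + m₂    ≤⟨ +-monoˡ-≤ m₂ gain₁ ⟩
  at q₁ v + m₂        ≤⟨ subst (λ w → at q₁ w + m₂ ≤ at q w) meet gain₂ ⟩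
  at q v              ∎)
  where
  open ≤-Reasoning
  v = pos₁ e₁

leftPath : ∀ {n} k → k < n → IsPath n id k
leftPath k k<n = record
  { adjacent = λ _ → inj₁ refl
  ; onPath   = λ c≤k → ≤-<-trans c≤k k<n
  ; distinct = λ c<d _ → <⇒≢ c<d
  }

rightPath : ∀ {n} k e → suc (k + e) ≡ n → IsPath n (k + e ∸_) e
rightPath k e refl = record
  { adjacent = λ c<e → inj₂ (sym (+-∸-assoc 1 (≤-trans c<e (m≤n+m e k))))
  ; onPath   = λ {c} _ → s≤s (m∸n≤m (k + e) c)
  ; distinct = λ c<d d≤e → <⇒≢ (∸-monoʳ-< c<d (≤-trans d≤e (m≤n+m e k))) ∘ sym
  }

suc[m+[n∸suc-o]]≡m+n∸o : ∀ m {n o} → o < n → suc (m + (n ∸ suc o)) ≡ m + n ∸ o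
suc[m+[n∸suc-o]]≡m+n∸o m {n} {o} o<n = begin
  suc (m + (n ∸ suc o)) ≡⟨ +-suc m (n ∸ suc o) ⟨
  m + suc (n ∸ suc o)   ≡⟨ cong (m +_) (+-∸-assoc 1 o<n) ⟨
  m + (n ∸ o)           ≡⟨ +-∸-assoc m (<⇒≤ o<n) ⟨
  m + n ∸ o             ∎
  where open ≡-Reasoning

m<m+n∸o : ∀ m {n o} → o < n → m < m + n ∸ o
m<m+n∸o m o<n = subst (m <_) (suc[m+[n∸suc-o]]≡m+n∸o m o<n) (s≤s (m≤m+n m _))

-- The summand `term` of ω, which ω keeps local, for a vertex c carrying a pebbles.
ωTerm : ℕ → ℕ → ℕ → ℕ → ℕ
ωTerm n k c a = if does (c <? k) then 2 ^ c * a
                else (if does (k <? c) then 2 ^ (n ∸ suc c) * a else 0)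

ωTerm-below : ∀ n {k c} a → c < k → ωTerm n k c a ≡ 2 ^ c * a
ωTerm-below n {k} {c} a c<k rewrite dec-true (c <? k) c<k = refl

ωTerm-self : ∀ n k a → ωTerm n k k a ≡ 0
ωTerm-self n k a rewrite dec-false (k <? k) (<-irrefl refl) = refl

ωTerm-above : ∀ n {k c} a → k < c → ωTerm n k c a ≡ 2 ^ (n ∸ suc c) * a
ωTerm-above n {k} {c} a k<c
  rewrite dec-false (c <? k) (<⇒≯ k<c) | dec-true (k <? c) k<c = refl

ω-as-sum : ∀ {n} (p : Distribution n) (k : Fin n) →
           ω p k ≡ sumBelow n (λ c → ωTerm n (toℕ k) c (at p c))
ω-as-sum {n} p k = sum-tabulate _ _ λ i → cong (ωTerm n (toℕ k) (toℕ i)) (sym (at-toℕ p i))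

-- Right of k the summands of ω, read from the far end n - 1 = k + e towards k, are the weights
-- along the path k + e, k + e - 1, …, k.
ω-sum-split : ∀ {n} k e (A : ℕ → ℕ) → suc (k + e) ≡ n →
  sumBelow n (λ c → ωTerm n k c (A c)) ≡ weight id A k + weight (k + e ∸_) A e
ω-sum-split k e A refl = begin
  sumBelow (suc k + e) g
    ≡⟨ sumBelow-+ (suc k) e g ⟩
  sumBelow k g + g k + sumBelow e (λ c → g (suc (k + c)))
    ≡⟨ cong₂ _+_ (cong₂ _+_ left (ωTerm-self (suc (k + e)) k (A k))) right ⟩
  weight id A k + 0 + weight (k + e ∸_) A e
    ≡⟨ cong (_+ weight (k + e ∸_) A e) (+-identityʳ _) ⟩
  weight id A k + weight (k + e ∸_) A e
    ∎
  where
  open ≡-Reasoning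
  g : ℕ → ℕ
  g c = ωTerm (suc (k + e)) k c (A c)
  left : sumBelow k g ≡ weight id A k
  left = sumBelow-cong k λ {c} → ωTerm-below (suc (k + e)) (A c)
  mirrored : ∀ {d} → d < e → g (suc (k + (e ∸ suc d))) ≡ 2 ^ d * A (k + e ∸ d)
  mirrored {d} d<e = begin
    g (suc (k + (e ∸ suc d)))  ≡⟨ cong g (suc[m+[n∸suc-o]]≡m+n∸o k d<e) ⟩
    g j                        ≡⟨ ωTerm-above (suc (k + e)) (A j) (m<m+n∸o k d<e) ⟩
    2 ^ (k + e ∸ j) * A j      ≡⟨ cong (λ x → 2 ^ x * A j) (m∸[m∸n]≡n d≤k+e) ⟩
    2 ^ d * A j                ∎
    where
    j = k + e ∸ d
    d≤k+e = ≤-trans (<⇒≤ d<e) (m≤n+m e k)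
  right : sumBelow e (λ c → g (suc (k + c))) ≡ weight (k + e ∸_) A e
  right = trans (sumBelow-reverse e _) (sumBelow-cong e mirrored)

suc[m+n]+1≡suc-m+suc-n : ∀ m n → suc (m + n) + 1 ≡ suc m + suc n
suc[m+n]+1≡suc-m+suc-n m n = trans (+-comm (suc (m + n)) 1) (sym (cong suc (+-suc m n)))

2*m≡m+m : ∀ m → 2 * m ≡ m + m
2*m≡m+m m = cong (m +_) (+-identityʳ m)

rightHalf⇒e≤k : ∀ {n} k e → suc (k + e) ≡ n → n + 1 ≤ 2 * suc k → e ≤ k
rightHalf⇒e≤k k e refl n+1≤2[1+k] = s≤s⁻¹ (+-cancelˡ-≤ (suc k) (suc e) (suc k) (begin
  suc k + suc e    ≡⟨ suc[m+n]+1≡suc-m+suc-n k e ⟨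
  suc (k + e) + 1  ≤⟨ n+1≤2[1+k] ⟩
  2 * suc k        ≡⟨ 2*m≡m+m (suc k) ⟩
  suc k + suc k    ∎))
  where open ≤-Reasoning

leftHalf⇒k≤e : ∀ {n} k e → suc (k + e) ≡ n → 2 * suc k < n + 1 → k ≤ e
leftHalf⇒k≤e k e refl 2[1+k]<n+1 = <⇒≤ (s<s⁻¹ (+-cancelˡ-< (suc k) (suc k) (suc e) (begin-strict
  suc k + suc k    ≡⟨ 2*m≡m+m (suc k) ⟨
  2 * suc k        <⟨ 2[1+k]<n+1 ⟩
  suc (k + e) + 1  ≡⟨ suc[m+n]+1≡suc-m+suc-n k e ⟩
  suc k + suc e    ∎)))
  where open ≤-Reasoning

m<[1+m/n]*n : ∀ m n .{{_ : NonZero n}} → m < suc (m / n) * n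
m<[1+m/n]*n m n = begin-strict
  m                   ≡⟨ m≡m%n+[m/n]*n m n ⟩
  m % n + m / n * n   <⟨ +-monoˡ-< (m / n * n) (m%n<n m n) ⟩
  n + m / n * n       ∎
  where open ≤-Reasoning

-- m + n < (m/a + 1) a + (n/b + 1) b ≤ (m/a + n/b + 1) a + b, the last step by b ≤ a.
t≤m/a+n/b : ∀ {a b} t m n .{{_ : NonZero a}} .{{_ : NonZero b}} → b ≤ a →
            t * a + b ∸ 1 ≤ m + n → t ≤ m / a + n / b
t≤m/a+n/b {a} {b} t m n b≤a bound =
  s≤s⁻¹ (*-cancelʳ-< a t (suc (x + y)) (+-cancelʳ-< b (t * a) _ ta+b<))
  where
  x = m / a
  y = n / b
  open ≤-Reasoning
  ta+b< : t * a + b < suc (x + y) * a + b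
  ta+b< = begin-strict
    t * a + b                   ≤⟨ m≤n+m∸n (t * a + b) 1 ⟩
    1 + (t * a + b ∸ 1)         ≤⟨ +-monoʳ-≤ 1 bound ⟩
    suc (m + n)                 <⟨ n<1+n _ ⟩
    suc (suc (m + n))           ≡⟨ cong suc (+-suc m n) ⟨
    suc m + suc n               ≤⟨ +-mono-≤ (m<[1+m/n]*n m a) (m<[1+m/n]*n n b) ⟩
    suc x * a + suc y * b       ≤⟨ +-monoʳ-≤ (suc x * a) (+-monoʳ-≤ b (*-monoʳ-≤ y b≤a)) ⟩
    suc x * a + (b + y * a)     ≡⟨ cong (suc x * a +_) (+-comm b (y * a)) ⟩
    suc x * a + (y * a + b)     ≡⟨ +-assoc (suc x * a) (y * a) b ⟨
    suc x * a + y * a + b       ≡⟨ cong (_+ b) (*-distribʳ-+ a (suc x) y) ⟨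
    suc (x + y) * a + b         ∎

corollary2p3 : (n : ℕ) (p : Distribution n) (k : Fin n) (t : ℕ) → 1 ≤ t →
    ((n + 1 ≤ 2 * suc (toℕ k)) × (t * 2 ^ toℕ k + 2 ^ (n ∸ suc (toℕ k)) ∸ 1 ≤ ω p k))
    ⊎ ((2 * suc (toℕ k) < n + 1) × (2 ^ toℕ k + t * 2 ^ (n ∸ suc (toℕ k)) ∸ 1 ≤ ω p k)) →
    Σ (Distribution n) (λ q → Reachable p q × (lookup p k + t ≤ lookup q k))
corollary2p3 n p k t _ hyp =
  let q , p↠q , gained = sweep-both (leftPath k₀ (toℕ<n k)) (rightPath k₀ e₀ n≡) (m+n∸n≡m k₀ e₀)
                           (λ d<e₀ _ d≤k₀ → >⇒≢ (≤-<-trans d≤k₀ (m<m+n∸o k₀ d<e₀)))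
                           p (L / 2 ^ k₀) (R / 2 ^ e₀) (m/n*n≤m L _) (m/n*n≤m R _)
  in q , p↠q , (begin
    lookup p k + t                        ≡⟨ cong (_+ t) (at-toℕ p k) ⟨
    at p k₀ + t                           ≤⟨ +-monoʳ-≤ (at p k₀) enough ⟩
    at p k₀ + (L / 2 ^ k₀ + R / 2 ^ e₀)  ≤⟨ gained ⟩
    at q k₀                               ≡⟨ at-toℕ q k ⟩
    lookup q k                            ∎)
  where
  open ≤-Reasoning
  k₀ = toℕ k
  e₀ = n ∸ suc k₀
  n≡ : suc (k₀ + e₀) ≡ n
  n≡ = m+[n∸m]≡n (toℕ<n k)
  instance
    2^k₀≢0 : NonZero (2 ^ k₀)
    2^k₀≢0 = m^n≢0 2 k₀
    2^e₀≢0 : NonZero (2 ^ e₀)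
    2^e₀≢0 = m^n≢0 2 e₀
  L = weight id (at p) k₀
  R = weight (k₀ + e₀ ∸_) (at p) e₀
  ω≡ : ω p k ≡ L + R
  ω≡ = trans (ω-as-sum p k) (ω-sum-split k₀ e₀ (at p) n≡)
  enough : t ≤ L / 2 ^ k₀ + R / 2 ^ e₀
  enough = [ (λ (rightHalf , bound) →
                t≤m/a+n/b t L R (^-monoʳ-≤ 2 (rightHalf⇒e≤k k₀ e₀ n≡ rightHalf))
                  (subst (_ ≤_) ω≡ bound))
           , (λ (leftHalf , bound) → subst (t ≤_) (+-comm (R / 2 ^ e₀) (L / 2 ^ k₀))
                (t≤m/a+n/b t R L (^-monoʳ-≤ 2 (leftHalf⇒k≤e k₀ e₀ n≡ leftHalf))
                  (subst₂ (λ u v → u ∸ 1 ≤ v) (+-comm (2 ^ k₀) (t * 2 ^ e₀))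
                          (trans ω≡ (+-comm L R)) bound)))
           ]′ hyp
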